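{- Fix a set of centers $\mathbf{C}\in\mathbf{S}^k$ and a hypothesis class $\mathcal{H}$ of $k$-wise partitions $h:\mathbf{I}\to[k]$. The pseudo-dimension of the set of loss functions $\{\ell_{\mathbf{C}}(h,\cdot): h\in\mathcal{H}\}$ is at most the $\Psi_B$-dimension of $\mathcal{H}$.
   Context: $\mathbf{S}$ has metric $d$; for $\mathbf{C}=(\mathbf{C}^{(1)},\dots,\mathbf{C}^{(k)})$, $\ell_{\mathbf{C}}(h,(I,S))=d(S,\mathbf{C}^{(h(I))})$. The pseudo-dimension of a class $\mathcal{F}$ of real-valued functions is the largest $n$ such that there exist points $x_1,\dots,x_n$ and thresholds $t_1,\dots,t_n\in\mathbb{R}$ such that for every $y\in\{0,1\}^n$ some $f\in\mathcal{F}$ has $f(x_i)>t_i$ iff $y_i=1$. A class $\mathcal{G}$ of functions $\mathbf{I}\to[k]$ $\Psi_B$-shatters $x_1,\dots,x_n$ if there exist $\psi_1,\dots,\psi_n:[k]\to\{0,1\}$ such that for every $y\in\{0,1\}^n$ there is $g\in\mathcal{G}$ with $\psi_i(g(x_i))=y_i$ for all $i$; the $\Psi_B$-dimension is the largest such $n$. -}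

module Defs where

open import Data.Nat using (ℕ)
open import Data.Fin using (Fin)
open import Data.Bool using (Bool; true)
open import Data.Product using (Σ; ∃; _×_; _,_)
open import Function.Bundles using (_⇔_)
open import Relation.Binary.PropositionalEquality using (_≡_)

loss : {I S R : Set} {k : ℕ} (d : S → S → R) (C : Fin k → S)
       (h : I → Fin k) → I × S → R
loss d C h (i , s) = d s (C (h i))

LossClass : {I S R : Set} {k : ℕ} (d : S → S → R) (C : Fin k → S)
            (H : (I → Fin k) → Set) → (I × S → R) → Set
LossClass d C H f = Σ _ λ h → H h × (f ≡ loss d C h)

PseudoShatters : {X R : Set} (_<_ : R → R → Set) (F : (X → R) → Set)
                 (n : ℕ) (xs : Fin n → X) → Set
PseudoShatters {X} {R} _<_ F n xs =
  Σ (Fin n → R) λ ts →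
    (y : Fin n → Bool) →
      Σ (X → R) λ f → F f × ((i : Fin n) → ((ts i < f (xs i)) ⇔ (y i ≡ true)))

PdimAtLeast : {X R : Set} (_<_ : R → R → Set) (F : (X → R) → Set) (n : ℕ) → Set
PdimAtLeast _<_ F n = Σ _ λ xs → PseudoShatters _<_ F n xs

ΨB-Shatters : {X : Set} {k : ℕ} (G : (X → Fin k) → Set)
              (n : ℕ) (xs : Fin n → X) → Set
ΨB-Shatters {X} {k} G n xs =
  Σ (Fin n → Fin k → Bool) λ ψ →
    (y : Fin n → Bool) →
      Σ (X → Fin k) λ g → G g × ((i : Fin n) → ψ i (g (xs i)) ≡ y i)

ΨB-DimAtLeast : {X : Set} {k : ℕ} (G : (X → Fin k) → Set) (n : ℕ) → Set
ΨB-DimAtLeast G n = Σ _ λ xs → ΨB-Shatters G n xs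

module Submission where

open import Defs
open import Data.Nat using (ℕ)
open import Data.Fin using (Fin)
open import Data.Fin.Properties using () renaming (_≟_ to _≟ᶠ_)
open import Data.Fin.Subset.Properties using (anySubset?)
open import Data.Bool using (Bool; true)
open import Data.Bool.Properties using (⇔→≡; ¬-not) renaming (_≟_ to _≟ᵇ_)
open import Data.Vec using (Vec; lookup; tabulate)
open import Data.Vec.Properties using (lookup∘tabulate)
open import Data.Product using (Σ; _×_; _,_; proj₁; proj₂)
open import Function using (_∘_)
open import Function.Bundles using (_⇔_; mk⇔; Equivalence)
open import Relation.Nullary using (Dec; yes; no; does)
open import Relation.Nullary.Decidable using (_×-dec_)
open import Relation.Binary.PropositionalEquality using (_≡_; refl; sym; trans; cong; subst)

-- The loss at the i-th point is d(Sᵢ, C(h Iᵢ)), so every threshold test there is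
-- a test on the single class h(Iᵢ).  Hence the labels of the shattering witnesses
-- are functions of their classes at the Iᵢ, and ψᵢ(j) can be taken to be 1 exactly
-- when some witness with label 1 at i puts Iᵢ into class j; this existential is
-- decidable because there are only 2ⁿ labellings.

loss-cong : {I S R : Set} {k : ℕ} (d : S → S → R) (C : Fin k → S)
            {h h′ : I → Fin k} (x : I × S) →
            h (proj₁ x) ≡ h′ (proj₁ x) → loss d C h x ≡ loss d C h′ x
loss-cong d C (i , s) e = cong (d s ∘ C) e

ΨB-shatters-if-labels-determined :
  {X : Set} {k n : ℕ} {G : (X → Fin k) → Set} (a : Fin n → X)
  (g : Vec Bool n → X → Fin k) → (∀ v → G (g v)) →
  (∀ v w i → g v (a i) ≡ g w (a i) → lookup v i ≡ lookup w i) →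
  ΨB-Shatters G n a
ΨB-shatters-if-labels-determined {k = k} {n = n} a g g∈G determined =
  ψ , λ y → g (tabulate y) , g∈G (tabulate y) , λ i →
    trans (ψ-correct (tabulate y) i) (lookup∘tabulate y i)
  where
  marked? : ∀ i j v → Dec (lookup v i ≡ true × g v (a i) ≡ j)
  marked? i j v = (lookup v i ≟ᵇ true) ×-dec (g v (a i) ≟ᶠ j)

  ψ : Fin n → Fin k → Bool
  ψ i j = does (anySubset? (marked? i j))

  ψ-correct : ∀ v i → ψ i (g v (a i)) ≡ lookup v i
  ψ-correct v i with anySubset? (marked? i (g v (a i)))
  ... | yes (w , wᵢ , gw≡gv) = trans (sym wᵢ) (determined w v i gw≡gv)
  ... | no ∄                 = sym (¬-not λ vᵢ → ∄ (v , vᵢ , refl))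

lemma4p8 : {I S R : Set} (_<_ : R → R → Set) (d : S → S → R)
           (k : ℕ) (C : Fin k → S) (H : (I → Fin k) → Set) →
           (n : ℕ) → PdimAtLeast _<_ (LossClass d C H) n → ΨB-DimAtLeast H n
lemma4p8 {I} _<_ d k C H n (xs , ts , shatter) =
  proj₁ ∘ xs ,
  ΨB-shatters-if-labels-determined (proj₁ ∘ xs) hyp (proj₁ ∘ proj₂ ∘ realise) determined
  where
  Realises : Vec Bool n → (I → Fin k) → Set
  Realises v h = H h × (∀ i → (ts i < loss d C h (xs i)) ⇔ (lookup v i ≡ true))

  realise : (v : Vec Bool n) → Σ (I → Fin k) (Realises v)
  realise v with shatter (lookup v)
  ... | _ , (h , h∈H , refl) , labels = h , h∈H , labels

  hyp : Vec Bool n → I → Fin k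
  hyp = proj₁ ∘ realise

  determined : ∀ v w i → hyp v (proj₁ (xs i)) ≡ hyp w (proj₁ (xs i)) → lookup v i ≡ lookup w i
  determined v w i same = ⇔→≡ (mk⇔
    (Equivalence.to (labels w) ∘ subst (ts i <_) loss≡ ∘ Equivalence.from (labels v))
    (Equivalence.to (labels v) ∘ subst (ts i <_) (sym loss≡) ∘ Equivalence.from (labels w)))
    where
    labels : ∀ u → (ts i < loss d C (hyp u) (xs i)) ⇔ (lookup u i ≡ true)
    labels u = proj₂ (proj₂ (realise u)) i
    loss≡ : loss d C (hyp v) (xs i) ≡ loss d C (hyp w) (xs i)
    loss≡ = loss-cong d C {hyp v} {hyp w} (xs i) same
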